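{- Define $\psi:\mathbb{N}\to\mathbb{N}$ by $$\psi(n)=\min\{\chi(G\times H) : G,H \text{ finite digraphs with } \chi(G)=\chi(H)=n\}.$$ If $\psi$ is bounded, then its least upper bound is at most $4$.
   Context: A (finite) digraph $G$ consists of a finite vertex set $V(G)$, a finite arc set $A(G)$ and maps $t_G,h_G:A(G)\to V(G)$ giving tail and head of each arc; loops (arcs with equal tail and head) are allowed. A homomorphism $G\to H$ is a pair of maps $V(G)\to V(H)$, $A(G)\to A(H)$ commuting with tails and heads. The product $G\times H$ has vertex set $V(G)\times V(H)$, arc set $A(G)\times A(H)$, with $t_{G\times H}=(t_G,t_H)$ and $h_{G\times H}=(h_G,h_H)$. $K_n$ is the digraph with vertices $\{0,\dots,n-1\}$ and arcs $(i,j)$ for all $i\neq j$. The chromatic number $\chi(G)$ is the least $n$ such that there is a homomorphism $G\to K_n$ (and $\chi(G)=\infty$ if $G$ has a loop). -}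

module Defs where

open import Data.Nat using (ℕ; _<_)
open import Data.Fin using (Fin)
open import Data.Product using (Σ; _×_; _,_; proj₁; proj₂; ∃-syntax)
open import Relation.Binary.PropositionalEquality using (_≡_; _≢_)
open import Relation.Nullary using (¬_)
open import Function.Bundles using (_↔_)

-- A digraph: vertex set, arc set, tail and head maps (loops and parallel arcs allowed).
record Digraph : Set₁ where
  field
    V    : Set
    A    : Set
    tail : A → V
    head : A → V
open Digraph public

IsFinite : Digraph → Set
IsFinite G = (∃[ k ] (V G ↔ Fin k)) × (∃[ l ] (A G ↔ Fin l))

record Hom (G H : Digraph) : Set where
  field
    vmap : V G → V H
    amap : A G → A H
    tail-comm : ∀ a → tail H (amap a) ≡ vmap (tail G a)
    head-comm : ∀ a → head H (amap a) ≡ vmap (head G a)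

_⊗_ : Digraph → Digraph → Digraph
G ⊗ H = record
  { V    = V G × V H
  ; A    = A G × A H
  ; tail = λ a → tail G (proj₁ a) , tail H (proj₂ a)
  ; head = λ a → head G (proj₁ a) , head H (proj₂ a)
  }

K : ℕ → Digraph
K n = record
  { V    = Fin n
  ; A    = Σ (Fin n × Fin n) (λ p → proj₁ p ≢ proj₂ p)
  ; tail = λ a → proj₁ (proj₁ a)
  ; head = λ a → proj₂ (proj₁ a)
  }

-- χ(G) = n  (so χ(G) = ∞, i.e. no homomorphism to any K_m, never equals a natural n).
ChromaticNumberIs : Digraph → ℕ → Set
ChromaticNumberIs G n = Hom G (K n) × (∀ m → m < n → ¬ Hom G (K m))

ChromaticAtMost : Digraph → ℕ → Set
ChromaticAtMost G b = Hom G (K b)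

-- ψ(n) ≤ b, where ψ(n) = min { χ(G×H) : G,H finite, χ(G) = χ(H) = n }:
-- the minimum is ≤ b iff some admissible pair has χ(G×H) ≤ b.
PsiAtMost : ℕ → ℕ → Set₁
PsiAtMost n b = ∃[ G ] ∃[ H ]
  (IsFinite G × IsFinite H × ChromaticNumberIs G n × ChromaticNumberIs H n
   × ChromaticAtMost (G ⊗ H) b)

PsiBounded : Set₁
PsiBounded = ∃[ B ] (∀ n → PsiAtMost n B)

-- Let δG be the arc digraph of G.  Colouring a vertex by the set of colours of its incoming arcs
-- gives χ(G) ≤ 2 ^ χ(δG); there is a homomorphism δG × δH → δ(G × H); and δK (n + 1) → K n for
-- n ≥ 4.  If ψ ≤ B, choose k with δ^k K B → K 4, and G, H with χ(G × H) ≤ B and χ(G) = χ(H)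
-- = 1 + tower k (n - 1).  Then δ^k G and δ^k H are not (n - 1)-colourable, while
-- δ^k G × δ^k H → δ^k (G × H) → δ^k K B → K 4.  Deleting arcs of δ^k G and δ^k H one at a time
-- brings their chromatic numbers down to exactly n.
module Submission where

open import Defs
open import Data.Bool using (Bool)
open import Data.Bool.Properties using (T-≡)
open import Data.Empty using (⊥; ⊥-elim)
open import Data.Fin using (Fin; zero; suc; fromℕ; inject₁; inject≤; funToFin; finToFun)
open import Data.Fin.Patterns using (0F; 1F; 2F; 3F)
open import Data.Fin.Properties
  using ( _≟_; any?; all?; ¬Fin0; inject≤-injective; fromℕ≢inject₁; inject₁-injective
        ; finToFun-funToFin; 2↔Bool)
open import Data.List using (List; length; lookup; filter; cartesianProduct; allFin)
open import Data.List.Membership.Propositional using (_∈_)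
open import Data.List.Membership.Propositional.Properties
  using (∈-lookup; ∈-filter⁺; ∈-filter⁻; ∈-cartesianProduct⁺; ∈-allFin)
open import Data.List.Relation.Unary.Any using (index)
open import Data.List.Relation.Unary.Any.Properties using (lookup-index)
open import Data.Nat using (ℕ; zero; suc; _+_; _^_; _≤_; z≤n; s≤s; s≤s⁻¹)
open import Data.Nat.Properties using (m≤n+m; n<1+n)
open import Data.Product using (Σ; ∃-syntax; _×_; _,_; proj₁; proj₂)
open import Function using (id; _∘_; Inverse)
open import Function.Bundles using (Equivalence)
open import Function.Properties.Inverse using (↔-refl)
open import Relation.Binary.PropositionalEquality
  using (_≡_; _≢_; refl; sym; trans; cong; cong₂; subst₂; module ≡-Reasoning)
open import Relation.Nullary using (¬_; Dec; yes; no)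
open import Relation.Nullary.Decidable using (map′; ¬?; _×-dec_; isYes; toWitness; fromWitness)

open Hom

variable
  G H I G′ H′ : Digraph
  k m n : ℕ

id-hom : Hom G G
id-hom = record { vmap = id ; amap = id ; tail-comm = λ _ → refl ; head-comm = λ _ → refl }

infixr 9 _∘-hom_
_∘-hom_ : Hom H I → Hom G H → Hom G I
g ∘-hom f = record
  { vmap = vmap g ∘ vmap f
  ; amap = amap g ∘ amap f
  ; tail-comm = λ a → trans (tail-comm g (amap f a)) (cong (vmap g) (tail-comm f a))
  ; head-comm = λ a → trans (head-comm g (amap f a)) (cong (vmap g) (head-comm f a))
  }

_⊗-hom_ : Hom G G′ → Hom H H′ → Hom (G ⊗ H) (G′ ⊗ H′)
f ⊗-hom g = record
  { vmap = λ (x , y) → vmap f x , vmap g y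
  ; amap = λ (a , b) → amap f a , amap g b
  ; tail-comm = λ (a , b) → cong₂ _,_ (tail-comm f a) (tail-comm g b)
  ; head-comm = λ (a , b) → cong₂ _,_ (head-comm f a) (head-comm g b)
  }

Proper : (G : Digraph) → (V G → Fin n) → Set
Proper G c = ∀ a → c (tail G a) ≢ c (head G a)

colouring : (c : V G → Fin n) → Proper G c → Hom G (K n)
colouring {G} c proper = record
  { vmap = c
  ; amap = λ a → (c (tail G a) , c (head G a)) , proper a
  ; tail-comm = λ _ → refl
  ; head-comm = λ _ → refl
  }

colouring-proper : (f : Hom G (K n)) → Proper G (vmap f)
colouring-proper f a eq = proj₂ (amap f a) (trans (tail-comm f a) (trans eq (sym (head-comm f a))))

arcless-colouring : (A G → ⊥) → Hom G (K (suc n))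
arcless-colouring no-arcs = colouring (λ _ → zero) (⊥-elim ∘ no-arcs)

K-mono : m ≤ n → Hom (K m) (K n)
K-mono m≤n =
  colouring (λ i → inject≤ i m≤n) (λ ((i , j) , i≢j) → i≢j ∘ inject≤-injective m≤n m≤n i j)

Loopless : Digraph → Set
Loopless G = ∀ a → tail G a ≢ head G a

colourable⇒loopless : Hom G (K n) → Loopless G
colourable⇒loopless f a = colouring-proper f a ∘ cong (vmap f)

χ-intro : Hom G (K (suc n)) → ¬ Hom G (K n) → ChromaticNumberIs G (suc n)
χ-intro f ¬g = f , λ _ m<1+n g → ¬g (K-mono (s≤s⁻¹ m<1+n) ∘-hom g)

δ : Digraph → Digraph
δ G = record
  { V = A G
  ; A = Σ (A G × A G) (λ (a , b) → head G a ≡ tail G b)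
  ; tail = λ ((a , _) , _) → a
  ; head = λ ((_ , b) , _) → b
  }

δ-map : Hom G H → Hom (δ G) (δ H)
δ-map f = record
  { vmap = amap f
  ; amap = λ ((a , b) , e) →
      (amap f a , amap f b) , trans (head-comm f a) (trans (cong (vmap f) e) (sym (tail-comm f b)))
  ; tail-comm = λ _ → refl
  ; head-comm = λ _ → refl
  }

δ-⊗ : Hom (δ G ⊗ δ H) (δ (G ⊗ H))
δ-⊗ = record
  { vmap = id
  ; amap = λ (((a , b) , e) , ((a′ , b′) , e′)) → ((a , a′) , (b , b′)) , cong₂ _,_ e e′
  ; tail-comm = λ _ → refl
  ; head-comm = λ _ → refl
  }

δ-colouring : Hom G (K n) → Hom (δ G) (K n)
δ-colouring {G} f = colouring (vmap f ∘ tail G)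
  (λ ((a , b) , e) eq → colouring-proper f a (trans eq (cong (vmap f) (sym e))))

-- The colour of the next arc is a label of this arc's head, so it differs from this arc's colour.
δ-colouring-by-labels : (L : V G → Fin n → Set) (c : A G → Fin n) →
  (∀ a → L (tail G a) (c a)) → (∀ a → ¬ L (head G a) (c a)) → Hom (δ G) (K n)
δ-colouring-by-labels L c label-tail ¬label-head =
  colouring c (λ ((a , b) , e) ca≡cb → ¬label-head a (subst₂ L (sym e) (sym ca≡cb) (label-tail b)))

-- Vertex i of K (5 + d) is labelled by a 2-subset of the d + 4 colours: {1,2}, {1,3}, or {0, i - 1}
-- for i ≥ 2.  Distinct vertices get distinct subsets, so choose i j is a label of i but not of j.
data Label {d : ℕ} : Fin (5 + d) → Fin (4 + d) → Set where
  label-0-1    : Label 0F 1F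
  label-0-2    : Label 0F 2F
  label-1-1    : Label 1F 1F
  label-1-3    : Label 1F 3F
  label-high-0 : ∀ {i} → Label (suc (suc i)) 0F
  label-high-s : ∀ {i} → Label (suc (suc i)) (suc i)

choose : ∀ {d} → Fin (5 + d) → Fin (5 + d) → Fin (4 + d)
choose (suc (suc i)) (suc (suc j)) = suc i
choose (suc (suc i)) _             = 0F
choose 0F (suc (suc (suc j)))      = 1F
choose 0F _                        = 2F
choose 1F (suc (suc (suc j)))      = 1F
choose 1F _                        = 3F

label-choose : ∀ {d} (i j : Fin (5 + d)) → Label i (choose i j)
label-choose (suc (suc i)) (suc (suc j)) = label-high-s
label-choose (suc (suc i)) 0F            = label-high-0
label-choose (suc (suc i)) 1F            = label-high-0
label-choose 0F 0F                       = label-0-2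
label-choose 0F 1F                       = label-0-2
label-choose 0F 2F                       = label-0-2
label-choose 0F (suc (suc (suc j)))      = label-0-1
label-choose 1F 0F                       = label-1-3
label-choose 1F 1F                       = label-1-3
label-choose 1F 2F                       = label-1-3
label-choose 1F (suc (suc (suc j)))      = label-1-1

¬label-choose : ∀ {d} (i j : Fin (5 + d)) → i ≢ j → ¬ Label j (choose i j)
¬label-choose (suc (suc i)) (suc (suc j)) i≢j label-high-s = i≢j refl
¬label-choose (suc (suc i)) 0F _ ()
¬label-choose (suc (suc i)) 1F _ ()
¬label-choose 0F 0F 0≢0 _ = 0≢0 refl
¬label-choose 0F 1F _ ()
¬label-choose 0F 2F _ ()
¬label-choose 0F (suc (suc (suc j))) _ ()
¬label-choose 1F 0F _ ()
¬label-choose 1F 1F 1≢1 _ = 1≢1 refl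
¬label-choose 1F 2F _ ()
¬label-choose 1F (suc (suc (suc j))) _ ()

δK-reduce : ∀ d → Hom (δ (K (5 + d))) (K (4 + d))
δK-reduce d = δ-colouring-by-labels {G = K (5 + d)} Label (λ ((i , j) , _) → choose i j)
  (λ ((i , j) , _) → label-choose i j) (λ ((i , j) , i≢j) → ¬label-choose i j i≢j)

δ^ : ℕ → Digraph → Digraph
δ^ zero    G = G
δ^ (suc k) G = δ^ k (δ G)

δ^-map : ∀ k → Hom G H → Hom (δ^ k G) (δ^ k H)
δ^-map zero    f = f
δ^-map (suc k) f = δ^-map k (δ-map f)

δ^-⊗ : ∀ k → Hom (δ^ k G ⊗ δ^ k H) (δ^ k (G ⊗ H))
δ^-⊗ zero    = id-hom
δ^-⊗ (suc k) = δ^-map k δ-⊗ ∘-hom δ^-⊗ k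

δ^-colouring : ∀ k → Hom G (K n) → Hom (δ^ k G) (K n)
δ^-colouring zero    f = f
δ^-colouring (suc k) f = δ^-colouring k (δ-colouring f)

δ^K→K4 : ∀ b → ∃[ k ] Hom (δ^ k (K b)) (K 4)
δ^K→K4 b = let (k , h) = δ^K4+→K4 b in k , h ∘-hom δ^-map k (K-mono (m≤n+m b 4))
  where
  δ^K4+→K4 : ∀ d → ∃[ k ] Hom (δ^ k (K (4 + d))) (K 4)
  δ^K4+→K4 zero    = 0 , id-hom
  δ^K4+→K4 (suc d) = let (k , h) = δ^K4+→K4 d in suc k , h ∘-hom δ^-map k (δK-reduce d)

record FinDigraph : Set where
  constructor finDigraph
  field
    vertices arcs : ℕ
    source target : Fin arcs → Fin vertices
open FinDigraph

⟦_⟧ : FinDigraph → Digraph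
⟦ X ⟧ = record { V = Fin (vertices X) ; A = Fin (arcs X) ; tail = source X ; head = target X }

⟦⟧-finite : ∀ X → IsFinite ⟦ X ⟧
⟦⟧-finite X = (vertices X , ↔-refl) , (arcs X , ↔-refl)

finite⇒presented : IsFinite G → ∃[ X ] (Hom G ⟦ X ⟧ × Hom ⟦ X ⟧ G)
finite⇒presented {G} ((k , v↔) , (l , a↔)) = X , to-X , from-X
  where
  open Inverse
  X : FinDigraph
  X = finDigraph k l (to v↔ ∘ tail G ∘ from a↔) (to v↔ ∘ head G ∘ from a↔)
  to-X : Hom G ⟦ X ⟧
  to-X = record
    { vmap = to v↔ ; amap = to a↔
    ; tail-comm = λ a → cong (to v↔ ∘ tail G) (strictlyInverseʳ a↔ a)
    ; head-comm = λ a → cong (to v↔ ∘ head G) (strictlyInverseʳ a↔ a)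
    }
  from-X : Hom ⟦ X ⟧ G
  from-X = record
    { vmap = from v↔ ; amap = from a↔
    ; tail-comm = λ _ → sym (strictlyInverseʳ v↔ _)
    ; head-comm = λ _ → sym (strictlyInverseʳ v↔ _)
    }

edgeless : ℕ → FinDigraph
edgeless n = finDigraph n 0 (λ ()) (λ ())

χ-edgeless : n ≤ 1 → ChromaticNumberIs ⟦ edgeless n ⟧ n
χ-edgeless z≤n       = colouring (λ ()) (λ ()) , λ _ ()
χ-edgeless (s≤s z≤n) = χ-intro (arcless-colouring (λ ())) (λ f → ¬Fin0 (vmap f zero))

ψ-edgeless : n ≤ 1 → PsiAtMost n 4
ψ-edgeless {n} n≤1 =
  ⟦ edgeless n ⟧ , ⟦ edgeless n ⟧ , ⟦⟧-finite (edgeless n) , ⟦⟧-finite (edgeless n) ,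
  χ-edgeless n≤1 , χ-edgeless n≤1 , arcless-colouring (λ { (() , _) })

colourable? : ∀ X n → Dec (Hom ⟦ X ⟧ (K n))
colourable? X n = map′ (λ (i , proper) → colouring (finToFun i) proper) decode
  (any? λ i → all? λ a → ¬? (finToFun i (source X a) ≟ finToFun i (target X a)))
  where
  decode : Hom ⟦ X ⟧ (K n) → ∃[ i ] Proper ⟦ X ⟧ (finToFun i)
  decode f = funToFin (vmap f) , λ a eq → colouring-proper f a
    (trans (sym (finToFun-funToFin (vmap f) _)) (trans eq (finToFun-funToFin (vmap f) _)))

fresh-colour : (Fin k → Fin n) → Fin k → Fin k → Fin (suc n)
fresh-colour {n = n} c v u with u ≟ v
... | yes _ = fromℕ n
... | no  _ = inject₁ (c u)

fresh-colour-separates : (c : Fin k → Fin n) (v : Fin k) {u w : Fin k} → u ≢ w →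
  (u ≢ v → w ≢ v → c u ≢ c w) → fresh-colour c v u ≢ fresh-colour c v w
fresh-colour-separates c v {u} {w} u≢w separated with u ≟ v | w ≟ v
... | yes u≡v | yes w≡v = λ _ → u≢w (trans u≡v (sym w≡v))
... | yes _   | no  _   = fromℕ≢inject₁
... | no  _   | yes _   = fromℕ≢inject₁ ∘ sym
... | no  u≢v | no  w≢v = separated u≢v w≢v ∘ inject₁-injective

-- Removing one arc lowers the chromatic number by at most one, so deleting arcs
-- one by one until the digraph becomes (n + 1)-colourable stops at chromatic number n + 2.
critical-subdigraph : ∀ X → Loopless ⟦ X ⟧ → ¬ Hom ⟦ X ⟧ (K (suc n)) →
  ∃[ Y ] (Hom ⟦ Y ⟧ ⟦ X ⟧ × ChromaticNumberIs ⟦ Y ⟧ (suc (suc n)))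
critical-subdigraph {n} (finDigraph k l s t) = go l s t
  where
  go : ∀ l (s t : Fin l → Fin k) →
    Loopless ⟦ finDigraph k l s t ⟧ → ¬ Hom ⟦ finDigraph k l s t ⟧ (K (suc n)) →
    ∃[ Y ] (Hom ⟦ Y ⟧ ⟦ finDigraph k l s t ⟧ × ChromaticNumberIs ⟦ Y ⟧ (suc (suc n)))
  go zero    s t _ ¬col = ⊥-elim (¬col (arcless-colouring (λ ())))
  go (suc l) s t loopless ¬col with colourable? (finDigraph k l (s ∘ suc) (t ∘ suc)) (suc n)
  ... | yes f = _ , id-hom , χ-intro (colouring (fresh-colour (vmap f) (t 0F)) proper) ¬col
    where
    proper : Proper ⟦ finDigraph k (suc l) s t ⟧ (fresh-colour (vmap f) (t 0F))
    proper zero    = fresh-colour-separates _ _ (loopless zero) (λ _ t0≢t0 → ⊥-elim (t0≢t0 refl))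
    proper (suc a) = fresh-colour-separates _ _ (loopless (suc a)) (λ _ _ → colouring-proper f a)
  ... | no ¬f =
    let (Y , Y→X⁻ , χY) = go l (s ∘ suc) (t ∘ suc) (loopless ∘ suc) ¬f
        X⁻→X = record { vmap = id ; amap = suc ; tail-comm = λ _ → refl ; head-comm = λ _ → refl }
    in Y , X⁻→X ∘-hom Y→X⁻ , χY

consecutive? : ∀ X (p : Fin (arcs X) × Fin (arcs X)) → Dec (target X (proj₁ p) ≡ source X (proj₂ p))
consecutive? X (a , b) = target X a ≟ source X b

consecutivePairs : ∀ X → List (Fin (arcs X) × Fin (arcs X))
consecutivePairs X = filter (consecutive? X) (cartesianProduct (allFin _) (allFin _))

δᶠ : FinDigraph → FinDigraph
δᶠ X = finDigraph (arcs X) (length (consecutivePairs X))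
  (proj₁ ∘ lookup (consecutivePairs X)) (proj₂ ∘ lookup (consecutivePairs X))

δᶠ-sound : ∀ X → Hom ⟦ δᶠ X ⟧ (δ ⟦ X ⟧)
δᶠ-sound X = record
  { vmap = id
  ; amap = λ i → lookup (consecutivePairs X) i ,
      proj₂ (∈-filter⁻ (consecutive? X) {xs = cartesianProduct (allFin _) (allFin _)} (∈-lookup i))
  ; tail-comm = λ _ → refl
  ; head-comm = λ _ → refl
  }

δᶠ-complete : ∀ X → Hom (δ ⟦ X ⟧) ⟦ δᶠ X ⟧
δᶠ-complete X = record
  { vmap = id
  ; amap = index ∘ listed
  ; tail-comm = λ x → cong proj₁ (sym (lookup-index (listed x)))
  ; head-comm = λ x → cong proj₂ (sym (lookup-index (listed x)))
  }
  where
  listed : (x : A (δ ⟦ X ⟧)) → proj₁ x ∈ consecutivePairs X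
  listed ((a , b) , e) = ∈-filter⁺ (consecutive? X) (∈-cartesianProduct⁺ (∈-allFin a) (∈-allFin b)) e

δᶠ^ : ℕ → FinDigraph → FinDigraph
δᶠ^ zero    X = X
δᶠ^ (suc k) X = δᶠ^ k (δᶠ X)

δᶠ^-sound : ∀ k X → Hom ⟦ δᶠ^ k X ⟧ (δ^ k ⟦ X ⟧)
δᶠ^-sound zero    X = id-hom
δᶠ^-sound (suc k) X = δ^-map k (δᶠ-sound X) ∘-hom δᶠ^-sound k (δᶠ X)

subsetCode : (Fin m → Bool) → Fin (2 ^ m)
subsetCode S = funToFin (Inverse.from 2↔Bool ∘ S)

subsetCode-injective : (S S′ : Fin m → Bool) → subsetCode S ≡ subsetCode S′ → ∀ c → S c ≡ S′ c
subsetCode-injective S S′ eq c = begin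
  S c                                      ≡⟨ sym (strictlyInverseˡ (S c)) ⟩
  to (from (S c))                          ≡⟨ cong to (sym (finToFun-funToFin (from ∘ S) c)) ⟩
  to (finToFun (subsetCode S) c)           ≡⟨ cong (λ i → to (finToFun i c)) eq ⟩
  to (finToFun (subsetCode S′) c)          ≡⟨ cong to (finToFun-funToFin (from ∘ S′) c) ⟩
  to (from (S′ c))                         ≡⟨ strictlyInverseˡ (S′ c) ⟩
  S′ c                                     ∎
  where
  open ≡-Reasoning
  open Inverse 2↔Bool

-- Equal in-colour sets at the ends of an arc a would put the colour of a on an arc into
-- the tail of a, and that arc is followed by a.
δ-lowerBound : ∀ X → Hom (δ ⟦ X ⟧) (K m) → Hom ⟦ X ⟧ (K (2 ^ m))
δ-lowerBound X f = colouring (subsetCode ∘ inColours) proper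
  where
  inColour? : ∀ v c → Dec (∃[ b ] (target X b ≡ v × vmap f b ≡ c))
  inColour? v c = any? λ b → (target X b ≟ v) ×-dec (vmap f b ≟ c)

  inColours : Fin (vertices X) → Fin _ → Bool
  inColours v c = isYes (inColour? v c)

  proper : Proper ⟦ X ⟧ (subsetCode ∘ inColours)
  proper a eq =
    let into-head = Equivalence.to T-≡ (fromWitness {a? = inColour? _ _} (a , refl , refl))
        into-tail = trans (subsetCode-injective _ _ eq (vmap f a)) into-head
        (b , b→tail , same-colour) = toWitness (Equivalence.from T-≡ into-tail)
    in colouring-proper f ((b , a) , b→tail) same-colour

tower : ℕ → ℕ → ℕ
tower zero    m = m
tower (suc k) m = 2 ^ tower k m

δᶠ^-lowerBound : ∀ k X → Hom ⟦ δᶠ^ k X ⟧ (K m) → Hom ⟦ X ⟧ (K (tower k m))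
δᶠ^-lowerBound zero    X f = f
δᶠ^-lowerBound (suc k) X f = δ-lowerBound X (δᶠ^-lowerBound k (δᶠ X) f ∘-hom δᶠ-complete X)

critical-subdigraph-of-δ^ : ∀ k → IsFinite G → Hom G (K m) → ¬ Hom G (K (tower k (suc n))) →
  ∃[ Y ] (IsFinite Y × ChromaticNumberIs Y (suc (suc n)) × Hom Y (δ^ k G))
critical-subdigraph-of-δ^ {G} {n = n} k finite G→K ¬G→K =
  let (X , G→X , X→G) = finite⇒presented finite
      Z→δ^G = δ^-map k X→G ∘-hom δᶠ^-sound k X
      ¬Z→K : ¬ Hom ⟦ δᶠ^ k X ⟧ (K (suc n))
      ¬Z→K f = ¬G→K (δᶠ^-lowerBound k X f ∘-hom G→X)
      Z-loopless = colourable⇒loopless (δ^-colouring k G→K ∘-hom Z→δ^G)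
      (Y , Y→Z , χY) = critical-subdigraph (δᶠ^ k X) Z-loopless ¬Z→K
  in ⟦ Y ⟧ , ⟦⟧-finite Y , χY , Z→δ^G ∘-hom Y→Z

mainTheorem1 : PsiBounded → ∀ (n : ℕ) → PsiAtMost n 4
mainTheorem1 _ 0 = ψ-edgeless z≤n
mainTheorem1 _ 1 = ψ-edgeless (s≤s z≤n)
mainTheorem1 (B , ψ≤B) (suc (suc n)) =
  let (k , δ^KB→K4) = δ^K→K4 B
      (G , H , finG , finH , (G→K , G-min) , (H→K , H-min) , G⊗H→KB) = ψ≤B (suc (tower k (suc n)))
      (YG , finYG , χYG , YG→δ^G) = critical-subdigraph-of-δ^ k finG G→K (G-min _ (n<1+n _))
      (YH , finYH , χYH , YH→δ^H) = critical-subdigraph-of-δ^ k finH H→K (H-min _ (n<1+n _))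
  in YG , YH , finYG , finYH , χYG , χYH ,
     δ^KB→K4 ∘-hom δ^-map k G⊗H→KB ∘-hom δ^-⊗ k ∘-hom (YG→δ^G ⊗-hom YH→δ^H)
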